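{- If a graph $G$ has a clique-construction ordering of length $k$, then $\mathrm{czf}(G)=|V(G)|-k$.
   Context: All graphs are finite and simple. Clique-construction ordering: let $(Z_1,\dots,Z_k)$ be a sequence of pairwise vertex-disjoint complete graphs, each of order at least $2$, and for each $i$ let $u_i$ be a vertex of $Z_i$. Let $G_1=Z_1$. For $1\le i\le k-1$, form $G_{i+1}$ from $G_i$ by choosing a clique $Y_i$ (a set of pairwise adjacent vertices) of $G_i$ contained in $V(G_i)\setminus\{u_1,\dots,u_i\}$, and adding $Z_{i+1}$ together with all edges $xy$ with $x\in V(Z_{i+1})$, $y\in Y_i$. The sequence $(Z_1,\dots,Z_k)$ is a clique-construction ordering of length $k$ of $G$ if for some choice of vertices $u_1,\dots,u_k$ and cliques $Y_1,\dots,Y_{k-1}$ in this process, $G=G_k$. Constrained zero forcing: start with a set $S\subseteq V(G)$ of colored vertices, all others uncolored. A colored vertex $c$ may force an uncolored vertex $u$ to become colored if $u$ is the only uncolored neighbor of $c$; only vertices of the initial set $S$ may ever force. $S$ is a constrained zero forcing set if some sequence of forces colors all vertices. $\mathrm{czf}(G)$ is the minimum size of a constrained zero forcing set. -}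

module Defs where

open import Data.Nat using (ℕ; _≤_; _<_)
open import Data.Bool using (Bool; true; false)
open import Data.Fin using (Fin; toℕ)
open import Data.Fin.Subset using (Subset; _∈_; _∉_; _∪_; ⁅_⁆; ⊤; ∣_∣)
open import Data.Product using (Σ; _×_)
open import Relation.Binary.PropositionalEquality using (_≡_; _≢_)
open import Relation.Binary.Construct.Closure.ReflexiveTransitive using (Star)

record Graph (n : ℕ) : Set where
  field
    adj     : Fin n → Fin n → Bool
    sym     : ∀ x y → adj x y ≡ adj y x
    irrefl  : ∀ x → adj x x ≡ false

open Graph public

Adj : ∀ {n} → Graph n → Fin n → Fin n → Set
Adj G x y = adj G x y ≡ true

-- A clique-construction ordering (Z_1,…,Z_k) of G, expressed directly on V(G):
-- blk x = index (0-based) of the block Z containing x; u i ∈ Z_i; Y j is the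
-- clique of G_{j} (the graph on blocks < j) to which Z_j is attached (j ≥ 1).
record CliqueConstructionOrdering {n : ℕ} (G : Graph n) (k : ℕ) : Set where
  field
    k≥1        : 1 ≤ k
    blk        : Fin n → Fin k
    u          : Fin k → Fin n
    u∈blk      : ∀ i → blk (u i) ≡ i
    order≥2    : ∀ i → Σ (Fin n) λ x → (blk x ≡ i) × (x ≢ u i)
    blkClique  : ∀ x y → blk x ≡ blk y → x ≢ y → Adj G x y
    Y          : Fin k → Subset n
    Y⊆earlier  : ∀ j y → y ∈ Y j → toℕ (blk y) < toℕ j
    Y∌u        : ∀ j i → toℕ i < toℕ j → u i ∉ Y j
    YClique    : ∀ j x y → x ∈ Y j → y ∈ Y j → x ≢ y → Adj G x y
    edgeY→     : ∀ x y → toℕ (blk y) < toℕ (blk x) → Adj G x y → y ∈ Y (blk x)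
    edgeY←     : ∀ x y → toℕ (blk y) < toℕ (blk x) → y ∈ Y (blk x) → Adj G x y

data Force {n : ℕ} (G : Graph n) (S : Subset n) : Subset n → Subset n → Set where
  force : ∀ {C} c v → c ∈ S → c ∈ C → v ∉ C → Adj G c v →
          (∀ w → Adj G c w → w ≢ v → w ∈ C) →
          Force G S C (C ∪ ⁅ v ⁆)

IsCZFS : ∀ {n} → Graph n → Subset n → Set
IsCZFS G S = Star (Force G S) S ⊤

IsCzf : ∀ {n} → Graph n → ℕ → Set
IsCzf {n} G m =
  (Σ (Subset n) λ S → IsCZFS G S × ∣ S ∣ ≡ m) ×
  (∀ S → IsCZFS G S → m ≤ ∣ S ∣)

{-# OPTIONS --safe #-}
-- Every edge of G lies in one of the k cliques Z_j ∪ Y_j, and a force c → v leaves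
-- the clique containing cv fully coloured; hence at most k forces occur. Conversely,
-- from V(G) ∖ {u_i} the blocks can be completed from the last to the first: a vertex
-- c ≠ u_j of Z_j forces u_j, because every neighbour of c in an earlier block lies in
-- Y_j, which contains no u_i.
module Submission where

open import Defs hiding (sym)
open import Data.Nat as ℕ using (ℕ; zero; suc; _+_; _∸_; _≤_; _<_; z≤n; _≤?_)
open import Data.Nat.Properties as ℕ using ()
open import Data.Bool using (true; false)
open import Data.Fin as Fin using (Fin; toℕ; fromℕ<; _≟_)
open import Data.Fin.Properties using (toℕ-injective; toℕ-fromℕ<)
open import Data.Fin.Subset
  using (Subset; _∈_; _∉_; _⊆_; _⊈_; _⊂_; _∪_; ⁅_⁆; ⊤; ∣_∣)
open import Data.Fin.Subset.Properties
  using ( _∈?_; _⊆?_; ⊆-antisym; ⊆⊤; ∣p∣≤n; ∣⊤∣≡n; p⊂q⇒∣p∣<∣q∣; p⊆p∪q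
        ; x∈p∪q⁺; x∈p∪q⁻; x∈⁅x⁆; x∈⁅y⁆⇒x≡y; ∪-identityʳ)
open import Data.Vec using (_∷_; here; there; tabulate)
open import Data.Vec.Properties using ([]=⇒lookup; lookup⇒[]=; lookup∘tabulate)
open import Data.Product using (_×_; _,_; ∃)
open import Data.Sum using (_⊎_; inj₁; inj₂)
open import Function using (_∘_)
open import Relation.Binary.Definitions using (tri<; tri≈; tri>)
open import Relation.Binary.PropositionalEquality
  using (_≡_; _≢_; refl; sym; trans; cong; subst; module ≡-Reasoning)
open import Relation.Binary.Construct.Closure.ReflexiveTransitive using (Star; ε; _◅_)
open import Relation.Nullary using (does; yes; no; ¬?; contradiction)
open import Relation.Nullary.Decidable using (_⊎-dec_; dec-true; dec-false; decidable-stable)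
open import Relation.Unary using (Pred; Decidable)
open import Level using (Level)

private variable
  ℓ : Level
  n k : ℕ

fromDec : {P : Pred (Fin n) ℓ} → Decidable P → Subset n
fromDec P? = tabulate (does ∘ P?)

module _ {P : Pred (Fin n) ℓ} (P? : Decidable P) {x : Fin n} where

  ∈-fromDec⁺ : P x → x ∈ fromDec P?
  ∈-fromDec⁺ px = lookup⇒[]= x _ (trans (lookup∘tabulate _ x) (dec-true (P? x) px))

  ∈-fromDec⁻ : x ∈ fromDec P? → P x
  ∈-fromDec⁻ x∈ = decidable-stable (P? x) λ ¬px →
    contradiction (trans (sym does≡true) (dec-false (P? x) ¬px)) λ ()
    where
    does≡true = trans (sym (lookup∘tabulate _ x)) ([]=⇒lookup x∈)

x∉p⇒∣p∪⁅x⁆∣≡1+∣p∣ : ∀ (p : Subset n) {x} → x ∉ p → ∣ p ∪ ⁅ x ⁆ ∣ ≡ suc ∣ p ∣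
x∉p⇒∣p∪⁅x⁆∣≡1+∣p∣ (true  ∷ p) {Fin.zero}  x∉p = contradiction here x∉p
x∉p⇒∣p∪⁅x⁆∣≡1+∣p∣ (false ∷ p) {Fin.zero}  x∉p = cong (suc ∘ ∣_∣) (∪-identityʳ p)
x∉p⇒∣p∪⁅x⁆∣≡1+∣p∣ (true  ∷ p) {Fin.suc x} x∉p = cong suc (x∉p⇒∣p∪⁅x⁆∣≡1+∣p∣ p (x∉p ∘ there))
x∉p⇒∣p∪⁅x⁆∣≡1+∣p∣ (false ∷ p) {Fin.suc x} x∉p = x∉p⇒∣p∪⁅x⁆∣≡1+∣p∣ p (x∉p ∘ there)

module _ {G : Graph n} {S : Subset n} where

  ∣force∣ : ∀ {C C′} → Force G S C C′ → ∣ C′ ∣ ≡ suc ∣ C ∣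
  ∣force∣ {C} (force _ _ _ _ v∉C _ _) = x∉p⇒∣p∪⁅x⁆∣≡1+∣p∣ C v∉C

  module _ (D : ℕ → Subset n) (step : ∀ {m} → m < k → Force G S (D (suc m)) (D m)) where

    descending-forces : ∀ {m} → m ≤ k → Star (Force G S) (D m) (D 0)
    descending-forces {zero}  _   = ε
    descending-forces {suc m} m<k = step m<k ◅ descending-forces (ℕ.<⇒≤ m<k)

    descending-size : ∀ {m} → m ≤ k → m + ∣ D m ∣ ≡ ∣ D 0 ∣
    descending-size {zero}  _   = refl
    descending-size {suc m} m<k = begin
      suc m + ∣ D (suc m) ∣  ≡⟨ sym (ℕ.+-suc m _) ⟩
      m + suc ∣ D (suc m) ∣  ≡⟨ cong (m +_) (sym (∣force∣ (step m<k))) ⟩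
      m + ∣ D m ∣            ≡⟨ descending-size (ℕ.<⇒≤ m<k) ⟩
      ∣ D 0 ∣                ∎
      where open ≡-Reasoning

record EdgeCliqueCover (G : Graph n) (k : ℕ) : Set where
  field
    clique   : Fin k → Subset n
    isClique : ∀ j {x y} → x ∈ clique j → y ∈ clique j → x ≢ y → Adj G x y
    covers   : ∀ {x y} → Adj G x y → ∃ λ j → x ∈ clique j × y ∈ clique j

module _ {G : Graph n} (cover : EdgeCliqueCover G k) where
  open EdgeCliqueCover cover

  unsaturated? : ∀ C → Decidable (λ j → clique j ⊈ C)
  unsaturated? C j = ¬? (clique j ⊆? C)

  unsaturated : Subset n → Subset k
  unsaturated C = fromDec (unsaturated? C)

  unsaturated-antitone : ∀ {C C′} → C ⊆ C′ → unsaturated C′ ⊆ unsaturated C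
  unsaturated-antitone {C} {C′} C⊆C′ j∈ =
    ∈-fromDec⁺ (unsaturated? C) λ K⊆C → ∈-fromDec⁻ (unsaturated? C′) j∈ (C⊆C′ ∘ K⊆C)

  force-shrinks-unsaturated : ∀ {S C C′} → Force G S C C′ → unsaturated C′ ⊂ unsaturated C
  force-shrinks-unsaturated {C = C} (force c v _ c∈C v∉C c~v rest) with covers c~v
  ... | j , c∈K , v∈K =
    unsaturated-antitone (p⊆p∪q ⁅ v ⁆) , j ,
    ∈-fromDec⁺ (unsaturated? C) (λ K⊆C → v∉C (K⊆C v∈K)) ,
    (λ j∈ → ∈-fromDec⁻ (unsaturated? (C ∪ ⁅ v ⁆)) j∈ K⊆C∪⁅v⁆)
    where
    K⊆C∪⁅v⁆ : clique j ⊆ C ∪ ⁅ v ⁆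
    K⊆C∪⁅v⁆ {x} x∈K with x ≟ v | x ≟ c
    ... | yes refl | _        = x∈p∪q⁺ (inj₂ (x∈⁅x⁆ v))
    ... | no _     | yes refl = x∈p∪q⁺ (inj₁ c∈C)
    ... | no x≢v   | no x≢c   = x∈p∪q⁺ (inj₁ (rest x (isClique j c∈K x∈K (x≢c ∘ sym)) x≢v))

  n≤∣unsaturated∣+∣colored∣ : ∀ {S C} → Star (Force G S) C ⊤ → n ≤ ∣ unsaturated C ∣ + ∣ C ∣
  n≤∣unsaturated∣+∣colored∣ ε = ℕ.≤-trans (ℕ.≤-reflexive (sym (∣⊤∣≡n n))) (ℕ.m≤n+m _ _)
  n≤∣unsaturated∣+∣colored∣ {C = C} (_◅_ {j = C′} f fs) = begin
    n                               ≤⟨ n≤∣unsaturated∣+∣colored∣ fs ⟩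
    ∣ unsaturated C′ ∣ + ∣ C′ ∣     ≡⟨ cong (∣ unsaturated C′ ∣ +_) (∣force∣ f) ⟩
    ∣ unsaturated C′ ∣ + suc ∣ C ∣  ≡⟨ ℕ.+-suc _ _ ⟩
    suc ∣ unsaturated C′ ∣ + ∣ C ∣  ≤⟨ ℕ.+-monoˡ-≤ _ (p⊂q⇒∣p∣<∣q∣ (force-shrinks-unsaturated f)) ⟩
    ∣ unsaturated C ∣ + ∣ C ∣       ∎
    where open ℕ.≤-Reasoning

  n∸k≤∣czfs∣ : ∀ {S} → IsCZFS G S → n ∸ k ≤ ∣ S ∣
  n∸k≤∣czfs∣ {S} forcing = ℕ.m≤n+o⇒m∸n≤o n k
    (ℕ.≤-trans (n≤∣unsaturated∣+∣colored∣ forcing) (ℕ.+-monoˡ-≤ _ (∣p∣≤n (unsaturated S))))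

module _ {G : Graph n} (O : CliqueConstructionOrdering G k) where
  open CliqueConstructionOrdering O

  adjacent-to-Y : ∀ {x y} → y ∈ Y (blk x) → Adj G x y
  adjacent-to-Y {x} {y} y∈Y = edgeY← x y (Y⊆earlier (blk x) y y∈Y) y∈Y

  block∪Y? : ∀ j → Decidable (λ x → blk x ≡ j ⊎ x ∈ Y j)
  block∪Y? j x = blk x ≟ j ⊎-dec x ∈? Y j

  block∪Y-isClique : ∀ j {x y} → blk x ≡ j ⊎ x ∈ Y j → blk y ≡ j ⊎ y ∈ Y j →
                     x ≢ y → Adj G x y
  block∪Y-isClique j {x} {y} (inj₁ refl) (inj₁ by) x≢y = blkClique x y (sym by) x≢y
  block∪Y-isClique j         (inj₁ refl) (inj₂ y∈Y) _   = adjacent-to-Y y∈Y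
  block∪Y-isClique j {x} {y} (inj₂ x∈Y)  (inj₁ refl) _  = trans (Graph.sym G x y) (adjacent-to-Y x∈Y)
  block∪Y-isClique j {x} {y} (inj₂ x∈Y)  (inj₂ y∈Y) x≢y = YClique j x y x∈Y y∈Y x≢y

  block∪Y-covers : ∀ {x y} → Adj G x y → ∃ λ j → (blk x ≡ j ⊎ x ∈ Y j) × (blk y ≡ j ⊎ y ∈ Y j)
  block∪Y-covers {x} {y} x~y with ℕ.<-cmp (toℕ (blk y)) (toℕ (blk x))
  ... | tri< y<x _ _ = blk x , inj₁ refl , inj₂ (edgeY→ x y y<x x~y)
  ... | tri≈ _ y≈x _ = blk x , inj₁ refl , inj₁ (toℕ-injective y≈x)
  ... | tri> _ _ x<y = blk y , inj₂ (edgeY→ y x x<y (trans (Graph.sym G y x) x~y)) , inj₁ refl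

  edgeCliqueCover : EdgeCliqueCover G k
  edgeCliqueCover = record
    { clique   = λ j → fromDec (block∪Y? j)
    ; isClique = λ j x∈ y∈ →
        block∪Y-isClique j (∈-fromDec⁻ (block∪Y? j) x∈) (∈-fromDec⁻ (block∪Y? j) y∈)
    ; covers   = λ x~y → let j , x∈ , y∈ = block∪Y-covers x~y in
        j , ∈-fromDec⁺ (block∪Y? j) x∈ , ∈-fromDec⁺ (block∪Y? j) y∈
    }

  earlier-neighbour-is-nonroot : ∀ {x y} → Adj G x y → toℕ (blk y) < toℕ (blk x) → u (blk y) ≢ y
  earlier-neighbour-is-nonroot {x} {y} x~y y<x root =
    Y∌u (blk x) (blk y) y<x (subst (_∈ Y (blk x)) (sym root) (edgeY→ x y y<x x~y))

  -- stage m is the colour set once u_{k-1}, …, u_m (blocks numbered from 0) have been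
  -- forced, in that order: stage k = V(G) ∖ {u_i} and stage 0 = V(G).
  colored? : ∀ m → Decidable (λ x → u (blk x) ≢ x ⊎ m ≤ toℕ (blk x))
  colored? m x = ¬? (u (blk x) ≟ x) ⊎-dec (m ≤? toℕ (blk x))

  stage : ℕ → Subset n
  stage m = fromDec (colored? m)

  nonroot∈stage : ∀ m {x} → u (blk x) ≢ x → x ∈ stage m
  nonroot∈stage m nonroot = ∈-fromDec⁺ (colored? m) (inj₁ nonroot)

  later∈stage : ∀ m {x} → m ≤ toℕ (blk x) → x ∈ stage m
  later∈stage m later = ∈-fromDec⁺ (colored? m) (inj₂ later)

  ∈stage⁻ : ∀ m {x} → x ∈ stage m → u (blk x) ≢ x ⊎ m ≤ toℕ (blk x)
  ∈stage⁻ m = ∈-fromDec⁻ (colored? m)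

  stage-0 : stage 0 ≡ ⊤
  stage-0 = ⊆-antisym ⊆⊤ (λ _ → later∈stage 0 z≤n)

  root∉stage : ∀ i → u i ∉ stage (suc (toℕ i))
  root∉stage i u∈ with ∈stage⁻ (suc (toℕ i)) u∈
  ... | inj₁ u≢u  = u≢u (cong u (u∈blk i))
  ... | inj₂ i<i  = ℕ.<-irrefl (cong toℕ (sym (u∈blk i))) i<i

  stage-suc : ∀ i → stage (suc (toℕ i)) ∪ ⁅ u i ⁆ ≡ stage (toℕ i)
  stage-suc i = ⊆-antisym ⊆stage ⊇stage
    where
    ⊆stage : stage (suc (toℕ i)) ∪ ⁅ u i ⁆ ⊆ stage (toℕ i)
    ⊆stage x∈ with x∈p∪q⁻ _ _ x∈
    ... | inj₂ x∈⁅u⁆ rewrite x∈⁅y⁆⇒x≡y _ x∈⁅u⁆ =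
      later∈stage (toℕ i) (ℕ.≤-reflexive (cong toℕ (sym (u∈blk i))))
    ... | inj₁ x∈′ with ∈stage⁻ (suc (toℕ i)) x∈′
    ...   | inj₁ nonroot = nonroot∈stage (toℕ i) nonroot
    ...   | inj₂ i<blk   = later∈stage (toℕ i) (ℕ.<⇒≤ i<blk)

    ⊇stage : stage (toℕ i) ⊆ stage (suc (toℕ i)) ∪ ⁅ u i ⁆
    ⊇stage {x} x∈ with ∈stage⁻ (toℕ i) x∈
    ... | inj₁ nonroot = x∈p∪q⁺ (inj₁ (nonroot∈stage (suc (toℕ i)) nonroot))
    ... | inj₂ i≤blk with ℕ.m≤n⇒m<n∨m≡n i≤blk | u (blk x) ≟ x
    ...   | inj₁ i<blk | _          = x∈p∪q⁺ (inj₁ (later∈stage (suc (toℕ i)) i<blk))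
    ...   | inj₂ _     | no nonroot = x∈p∪q⁺ (inj₁ (nonroot∈stage (suc (toℕ i)) nonroot))
    ...   | inj₂ i≡blk | yes root   = x∈p∪q⁺ (inj₂ (subst (_∈ ⁅ u i ⁆)
            (trans (cong u (toℕ-injective i≡blk)) root) (x∈⁅x⁆ (u i))))

  neighbour∈stage : ∀ {x w} → Adj G x w → w ≢ u (blk x) → w ∈ stage (suc (toℕ (blk x)))
  neighbour∈stage {x} {w} x~w w≢u with ℕ.<-cmp (toℕ (blk w)) (toℕ (blk x))
  ... | tri< w<x _ _ = nonroot∈stage (suc (toℕ (blk x))) (earlier-neighbour-is-nonroot x~w w<x)
  ... | tri≈ _ w≈x _ = nonroot∈stage (suc (toℕ (blk x))) λ root →
                         w≢u (trans (sym root) (cong u (toℕ-injective w≈x)))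
  ... | tri> _ _ x<w = later∈stage (suc (toℕ (blk x))) x<w

  root-forced : ∀ i → Force G (stage k) (stage (suc (toℕ i))) (stage (toℕ i))
  root-forced i with order≥2 i
  ... | c , refl , c≢u =
    subst (Force G (stage k) (stage (suc (toℕ (blk c))))) (stage-suc (blk c))
      (force c (u (blk c)) (nonroot∈stage k c≢u′) (nonroot∈stage (suc (toℕ (blk c))) c≢u′)
             (root∉stage (blk c)) (blkClique c (u (blk c)) (sym (u∈blk (blk c))) c≢u)
             (λ _ → neighbour∈stage))
    where
    c≢u′ : u (blk c) ≢ c
    c≢u′ = c≢u ∘ sym

  forcing-step : ∀ {m} → m < k → Force G (stage k) (stage (suc m)) (stage m)
  forcing-step m<k = subst (λ m → Force G (stage k) (stage (suc m)) (stage m))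
                           (toℕ-fromℕ< m<k) (root-forced (fromℕ< m<k))

  stage-k-isCZFS : IsCZFS G (stage k)
  stage-k-isCZFS = subst (Star (Force G (stage k)) (stage k)) stage-0
    (descending-forces stage forcing-step ℕ.≤-refl)

  ∣stage-k∣≡n∸k : ∣ stage k ∣ ≡ n ∸ k
  ∣stage-k∣≡n∸k = begin
    ∣ stage k ∣              ≡⟨ sym (ℕ.m+n∸m≡n k _) ⟩
    k + ∣ stage k ∣ ∸ k      ≡⟨ cong (_∸ k) (descending-size stage forcing-step ℕ.≤-refl) ⟩
    ∣ stage 0 ∣ ∸ k          ≡⟨ cong (λ C → ∣ C ∣ ∸ k) stage-0 ⟩
    ∣ ⊤ {n} ∣ ∸ k            ≡⟨ cong (_∸ k) (∣⊤∣≡n n) ⟩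
    n ∸ k                    ∎
    where open ≡-Reasoning

mainTheorem14 : ∀ {n k : ℕ} (G : Graph n) → CliqueConstructionOrdering G k →
                IsCzf G (n ∸ k)
mainTheorem14 {k = k} G O =
  (stage O k , stage-k-isCZFS O , ∣stage-k∣≡n∸k O) , λ _ → n∸k≤∣czfs∣ (edgeCliqueCover O)
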